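{- Let $k$ be a positive odd integer, $R$ an $n$-tournament, and $R(a_1,\dots,a_n)$ a transitive blowup of $R$ (with $a_1,\dots,a_n$ positive integers). Then $R\in\mathcal{D}_k$ if and only if $R(a_1,\dots,a_n)\in\mathcal{D}_k$.
   Context: A tournament is a directed graph with exactly one arc between each pair of distinct vertices; $u\rightarrow v$ means the arc goes from $u$ to $v$. For a tournament $T$ on vertices $v_1,\dots,v_n$, its skew-adjacency matrix is the zero-diagonal matrix $S_T=[s_{ij}]$ with $s_{ij}=-s_{ji}=1$ if $v_i\rightarrow v_j$, and $\det(T):=\det(S_T)$. A subtournament is the tournament induced by a nonempty vertex subset (including $T$ itself). $\mathcal{D}_k$ is the set of tournaments all of whose subtournaments have determinant at most $k^2$. A tournament is transitive if it has no directed 3-cycle. For an $n$-tournament $R$ with vertices $v_1,\dots,v_n$ and positive integers $a_1,\dots,a_n$, the transitive blowup $R(a_1,\dots,a_n)$ replaces each $v_i$ by a transitive tournament on $a_i$ vertices, with all arcs from the $i$-th block to the $j$-th block whenever $v_i\rightarrow v_j$ in $R$. -}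

module Defs where

open import Data.Nat using (ℕ; zero; suc; _^_) renaming (_+_ to _+ℕ_; _*_ to _*ℕ_)
open import Data.Bool using (Bool; true; false; not; if_then_else_)
open import Data.Fin using (Fin; zero; suc; splitAt; punchIn; _≟_)
open import Data.Integer using (ℤ; +_; -_; _+_; _*_; _≤_; 0ℤ; 1ℤ)
open import Data.Product using (Σ; _,_; ∃)
open import Data.Sum using (inj₁; inj₂)
open import Data.Empty using (⊥)
open import Relation.Nullary using (yes; no)
open import Relation.Binary.PropositionalEquality using (_≡_; _≢_; refl)
open import Function using (_∘_)
open import Function.Definitions using (Injective)

-- A tournament on vertex set Fin n: arc i j ≡ true means v_i → v_j.
record Tournament (n : ℕ) : Set where
  field
    arc    : Fin n → Fin n → Bool
    irrefl : ∀ i → arc i i ≡ false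
    tourn  : ∀ i j → i ≢ j → arc i j ≡ not (arc j i)
open Tournament public

sumFin : ∀ {n} → (Fin n → ℤ) → ℤ
sumFin {zero}  f = 0ℤ
sumFin {suc n} f = f zero + sumFin (f ∘ suc)

sign : ℕ → ℤ
sign zero    = 1ℤ
sign (suc k) = - sign k

det : ∀ {n} → (Fin n → Fin n → ℤ) → ℤ
det {zero}  M = 1ℤ
det {suc n} M =
  sumFin (λ j → sign (Data.Fin.toℕ j) * (M zero j * det (λ r c → M (suc r) (punchIn j c))))

skew : ∀ {n} → (Fin n → Fin n → Bool) → Fin n → Fin n → ℤ
skew a i j = if a i j then 1ℤ else (if a j i then - 1ℤ else 0ℤ)

-- D_k: every subtournament (induced by a nonempty vertex subset, given as an
-- injective enumeration Fin (suc m) → Fin n) has determinant ≤ k².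
InD : ℕ → ∀ {n} → (Fin n → Fin n → Bool) → Set
InD k {n} a = ∀ m (f : Fin (suc m) → Fin n) → Injective _≡_ _≡_ f →
  det (skew (λ i j → a (f i) (f j))) ≤ + (k ^ 2)

Odd : ℕ → Set
Odd k = ∃ λ m → k ≡ suc (2 *ℕ m)

Transitive : ∀ {n} → Tournament n → Set
Transitive {n} T = ∀ (i j l : Fin n) → arc T i j ≡ true → arc T j l ≡ true → arc T l i ≡ true → ⊥

total : ∀ n → (Fin n → ℕ) → ℕ
total zero    a = 0
total (suc n) a = a zero +ℕ total n (a ∘ suc)

decode : ∀ n (a : Fin n → ℕ) → Fin (total n a) → Σ (Fin n) (λ i → Fin (a i))
decode (suc n) a x with splitAt (a zero) x
... | inj₁ p = zero , p
... | inj₂ y with decode n (a ∘ suc) y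
...   | i , q = suc i , q

blowArc' : ∀ {n} (R : Tournament n) (a : Fin n → ℕ) (T : (i : Fin n) → Tournament (a i)) →
  (i : Fin n) → Fin (a i) → (j : Fin n) → Fin (a j) → Bool
blowArc' R a T i p j q with i ≟ j
... | yes refl = arc (T i) p q
... | no _     = arc R i j

blowupArc : ∀ {n} (R : Tournament n) (a : Fin n → ℕ) (T : (i : Fin n) → Tournament (a i)) →
  Fin (total n a) → Fin (total n a) → Bool
blowupArc {n} R a T x y with decode n a x | decode n a y
... | i , p | j , q = blowArc' R a T i p j q

module Submission where

-- Let X be the subtournament of the blowup B = R(a₁,…,aₙ) induced by some vertices. If X meets
-- every block at most once, it is a copy of a subtournament of R. Otherwise some block contains
-- two vertices u → v of X with no vertex of X between them in the transitive order of the block.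
-- Every other vertex of X sees u and v alike, and subtracting row v from row u of S_X shows
-- det X = det (X − u − v). Induction on |X| therefore bounds det X by k², the empty
-- subtournament (determinant 1) being where k ≥ 1 is used. Conversely, one vertex from each
-- block induces a copy of R in B.

open import Defs
open import Data.Nat using (ℕ; _≤_)
open import Data.Fin using (Fin)
open import Data.Product using (_×_)
open import Function.Bundles using (_⇔_)

module SumFin where

  open import Data.Nat using (zero; suc)
  open import Data.Fin using (zero; suc; punchIn)
  open import Data.Integer using (ℤ; -_; _+_; _*_; 0ℤ)
  open import Data.Integer.Properties using (+-*-semiring; neg-distrib-+)
  open import Algebra.Properties.Semiring.Sum +-*-semiring
    using (sum; sum-cong-≗; ∑-distrib-+; ∑-comm; sum-remove; *-distribˡ-sum)
  open import Relation.Binary.PropositionalEquality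
  open import Function using (_∘_)

  sumFin≡sum : ∀ {n} (f : Fin n → ℤ) → sumFin f ≡ sum f
  sumFin≡sum {zero}  f = refl
  sumFin≡sum {suc n} f = cong (f zero +_) (sumFin≡sum (f ∘ suc))

  private
    via-sum : ∀ {m n} {f : Fin m → ℤ} {g : Fin n → ℤ} → sum f ≡ sum g → sumFin f ≡ sumFin g
    via-sum {f = f} {g} eq = trans (sumFin≡sum f) (trans eq (sym (sumFin≡sum g)))

  sumFin-cong : ∀ {n} {f g : Fin n → ℤ} → (∀ i → f i ≡ g i) → sumFin f ≡ sumFin g
  sumFin-cong {f = f} {g} eq = via-sum {f = f} {g} (sum-cong-≗ eq)

  sumFin-distrib-+ : ∀ {n} (f g : Fin n → ℤ) → sumFin (λ i → f i + g i) ≡ sumFin f + sumFin g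
  sumFin-distrib-+ f g = trans (sumFin≡sum (λ i → f i + g i))
    (trans (∑-distrib-+ f g) (sym (cong₂ _+_ (sumFin≡sum f) (sumFin≡sum g))))

  *-distribˡ-sumFin : ∀ {n} c (f : Fin n → ℤ) → c * sumFin f ≡ sumFin (λ i → c * f i)
  *-distribˡ-sumFin c f = trans (cong (c *_) (sumFin≡sum f))
    (trans (*-distribˡ-sum c f) (sym (sumFin≡sum (λ i → c * f i))))

  sumFin-remove : ∀ {n} (f : Fin (suc n) → ℤ) i → sumFin f ≡ f i + sumFin (f ∘ punchIn i)
  sumFin-remove f i = trans (sumFin≡sum f)
    (trans (sum-remove f) (sym (cong (f i +_) (sumFin≡sum (f ∘ punchIn i)))))

  sumFin-comm : ∀ {m n} (f : Fin m → Fin n → ℤ) →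
    sumFin (λ i → sumFin (f i)) ≡ sumFin (λ j → sumFin (λ i → f i j))
  sumFin-comm {m} {n} f = trans (sumFin-cong (λ i → sumFin≡sum (f i)))
    (via-sum {f = λ i → sum {n} (f i)} {λ j → sumFin (λ i → f i j)}
      (trans (∑-comm f) (sum-cong-≗ (λ j → sym (sumFin≡sum (λ i → f i j))))))

  sumFin-neg : ∀ {n} (f : Fin n → ℤ) → sumFin (λ i → - f i) ≡ - sumFin f
  sumFin-neg {zero}  f = refl
  sumFin-neg {suc n} f = trans (cong (- f zero +_) (sumFin-neg (f ∘ suc)))
    (sym (neg-distrib-+ (f zero) (sumFin (f ∘ suc))))

  sumFin-zero : ∀ {n} (f : Fin n → ℤ) → (∀ i → f i ≡ 0ℤ) → sumFin f ≡ 0ℤ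
  sumFin-zero {zero}  f eq = refl
  sumFin-zero {suc n} f eq = cong₂ _+_ (eq zero) (sumFin-zero (f ∘ suc) (eq ∘ suc))

module Determinant where

  open import Data.Nat using (zero; suc)
  open import Data.Fin using (zero; suc; punchIn; toℕ; inject₁; lift)
  open import Data.Fin.Induction using (<-weakInduction)
  open import Data.Integer using (ℤ; -_; _+_; _-_; _*_; 0ℤ; 1ℤ)
  open import Data.Integer.Properties using (neg-involutive; +-identityˡ; +-identityʳ; +-inverseʳ)
  open import Data.Integer.Tactic.RingSolver using (solve-∀)
  open import Data.Product using (_,_; proj₁; proj₂)
  open import Relation.Binary.PropositionalEquality
  open import Function using (_∘_; id)
  open SumFin

  Matrix : ℕ → Set
  Matrix n = Fin n → Fin n → ℤ

  sgn : ∀ {n} → Fin n → ℤ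
  sgn j = sign (toℕ j)

  minor : ∀ {n} → Matrix (suc n) → Fin (suc n) → Matrix n
  minor M j r c = M (suc r) (punchIn j c)

  laplaceTerm : ∀ {n} → Matrix (suc n) → Fin (suc n) → ℤ
  laplaceTerm M j = sgn j * (M zero j * det (minor M j))

  det-cong : ∀ {n} {M N : Matrix n} → (∀ r c → M r c ≡ N r c) → det M ≡ det N
  det-cong {zero}  eq = refl
  det-cong {suc n} eq = sumFin-cong λ j →
    cong₂ (λ x d → sgn j * (x * d)) (eq zero j) (det-cong (λ r c → eq (suc r) (punchIn j c)))

  x≡-x⇒x≡0 : ∀ {x} → x ≡ - x → x ≡ 0ℤ
  x≡-x⇒x≡0 {ℤ.pos zero}    eq = refl
  x≡-x⇒x≡0 {ℤ.pos (suc n)} ()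
  x≡-x⇒x≡0 {ℤ.negsuc n}    ()

  replaceRow0 : ∀ {n} → (Fin (suc n) → ℤ) → Matrix (suc n) → Matrix (suc n)
  replaceRow0 x M zero    = x
  replaceRow0 x M (suc r) = M (suc r)

  replaceCol0 : ∀ {n} → (Fin (suc n) → ℤ) → Matrix (suc n) → Matrix (suc n)
  replaceCol0 x M r zero    = x r
  replaceCol0 x M r (suc c) = M r (suc c)

  det-replaceRow0-+ : ∀ {n} (x y : Fin (suc n) → ℤ) (M : Matrix (suc n)) →
    det (replaceRow0 (λ j → x j + y j) M) ≡ det (replaceRow0 x M) + det (replaceRow0 y M)
  det-replaceRow0-+ x y M = trans (sumFin-cong λ j → distrib (sgn j) (x j) (y j) (det (minor M j)))
    (sumFin-distrib-+ (laplaceTerm (replaceRow0 x M)) (laplaceTerm (replaceRow0 y M)))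
    where
    distrib : ∀ s a b d → s * ((a + b) * d) ≡ s * (a * d) + s * (b * d)
    distrib = solve-∀

  minor-replaceCol0 : ∀ {n} x (M : Matrix (suc (suc n))) j r c →
    minor (replaceCol0 x M) (suc j) r c ≡ replaceCol0 (x ∘ suc) (minor M (suc j)) r c
  minor-replaceCol0 x M j r zero    = refl
  minor-replaceCol0 x M j r (suc c) = refl

  mutual
    det-replaceCol0-+ : ∀ {n} (x y : Fin (suc n) → ℤ) (M : Matrix (suc n)) →
      det (replaceCol0 (λ r → x r + y r) M) ≡ det (replaceCol0 x M) + det (replaceCol0 y M)
    det-replaceCol0-+ x y M = trans (sumFin-cong (laplaceTerm-replaceCol0-+ x y M))
      (sumFin-distrib-+ (laplaceTerm (replaceCol0 x M)) (laplaceTerm (replaceCol0 y M)))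

    laplaceTerm-replaceCol0-+ : ∀ {n} (x y : Fin (suc n) → ℤ) (M : Matrix (suc n)) j →
      laplaceTerm (replaceCol0 (λ r → x r + y r) M) j ≡
      laplaceTerm (replaceCol0 x M) j + laplaceTerm (replaceCol0 y M) j
    laplaceTerm-replaceCol0-+ x y M zero = distrib (x zero) (y zero) (det (minor M zero))
      where
      distrib : ∀ a b d → 1ℤ * ((a + b) * d) ≡ 1ℤ * (a * d) + 1ℤ * (b * d)
      distrib = solve-∀
    laplaceTerm-replaceCol0-+ {suc n} x y M (suc j) = begin
      sgn (suc j) * (M zero (suc j) * det (minor (replaceCol0 (λ r → x r + y r) M) (suc j)))
        ≡⟨ cong (λ d → sgn (suc j) * (M zero (suc j) * d)) minors ⟩
      sgn (suc j) * (M zero (suc j) * (det (minor (replaceCol0 x M) (suc j)) +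
                                       det (minor (replaceCol0 y M) (suc j))))
        ≡⟨ distrib (sgn (suc j)) (M zero (suc j)) _ _ ⟩
      laplaceTerm (replaceCol0 x M) (suc j) + laplaceTerm (replaceCol0 y M) (suc j) ∎
      where
      open ≡-Reasoning
      distrib : ∀ s a d e → s * (a * (d + e)) ≡ s * (a * d) + s * (a * e)
      distrib = solve-∀
      minors : det (minor (replaceCol0 (λ r → x r + y r) M) (suc j)) ≡
               det (minor (replaceCol0 x M) (suc j)) + det (minor (replaceCol0 y M) (suc j))
      minors = trans (det-cong (minor-replaceCol0 (λ r → x r + y r) M j))
        (trans (det-replaceCol0-+ (x ∘ suc) (y ∘ suc) (minor M (suc j)))
          (sym (cong₂ _+_ (det-cong (minor-replaceCol0 x M j)) (det-cong (minor-replaceCol0 y M j)))))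

  mutual
    det-col0-zero : ∀ {n} (M : Matrix (suc n)) → (∀ r → M r zero ≡ 0ℤ) → det M ≡ 0ℤ
    det-col0-zero M eq = cong₂ _+_ head (laplaceTail-zero M (eq ∘ suc))
      where
      head : laplaceTerm M zero ≡ 0ℤ
      head = trans (cong (λ x → 1ℤ * (x * det (minor M zero))) (eq zero)) (vanish (det (minor M zero)))
        where
        vanish : ∀ d → 1ℤ * (0ℤ * d) ≡ 0ℤ
        vanish = solve-∀

    laplaceTail-zero : ∀ {n} (M : Matrix (suc n)) → (∀ r → M (suc r) zero ≡ 0ℤ) →
      sumFin (laplaceTerm M ∘ suc) ≡ 0ℤ
    laplaceTail-zero {zero}  M eq = refl
    laplaceTail-zero {suc n} M eq = sumFin-zero (laplaceTerm M ∘ suc) λ j →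
      trans (cong (λ d → sgn (suc j) * (M zero (suc j) * d)) (det-col0-zero (minor M (suc j)) eq))
        (vanish (sgn (suc j)) (M zero (suc j)))
      where
      vanish : ∀ s a → s * (a * 0ℤ) ≡ 0ℤ
      vanish = solve-∀

  e₀ : ∀ {n} → Fin (suc n) → ℤ
  e₀ zero    = 1ℤ
  e₀ (suc r) = 0ℤ

  det-replaceCol0-e₀ : ∀ {n} (M : Matrix (suc n)) → det (replaceCol0 e₀ M) ≡ det (minor M zero)
  det-replaceCol0-e₀ M =
    trans (cong₂ _+_ (unit (det (minor M zero))) (laplaceTail-zero (replaceCol0 e₀ M) (λ r → refl)))
      (+-identityʳ (det (minor M zero)))
    where
    unit : ∀ d → 1ℤ * (1ℤ * d) ≡ d
    unit = solve-∀

  sgnDiff : ∀ {n} → Fin n → Fin n → ℤ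
  sgnDiff zero    zero    = 0ℤ
  sgnDiff zero    (suc b) = - 1ℤ
  sgnDiff (suc a) zero    = 1ℤ
  sgnDiff (suc a) (suc b) = sgnDiff a b

  sgnDiff-antisym : ∀ {n} (a b : Fin n) → sgnDiff b a ≡ - sgnDiff a b
  sgnDiff-antisym zero    zero    = refl
  sgnDiff-antisym zero    (suc b) = refl
  sgnDiff-antisym (suc a) zero    = refl
  sgnDiff-antisym (suc a) (suc b) = sgnDiff-antisym a b

  sgnDiff-diag : ∀ {n} (a : Fin n) → sgnDiff a a ≡ 0ℤ
  sgnDiff-diag zero    = refl
  sgnDiff-diag (suc a) = sgnDiff-diag a

  sgnDiff-punchIn : ∀ {n} (a : Fin (suc n)) (l : Fin n) →
    sgnDiff a (punchIn a l) * sgn (punchIn a l) ≡ sgn l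
  sgnDiff-punchIn zero    l       = negate-twice (sgn l)
    where
    negate-twice : ∀ x → - 1ℤ * - x ≡ x
    negate-twice = solve-∀
  sgnDiff-punchIn (suc a) zero    = refl
  sgnDiff-punchIn (suc a) (suc l) =
    trans (pull (sgnDiff a (punchIn a l)) (sgn (punchIn a l))) (cong -_ (sgnDiff-punchIn a l))
    where
    pull : ∀ e x → e * - x ≡ - (e * x)
    pull = solve-∀

  -- For a ≢ b, punchIn₂ a b enumerates Fin (2 + n) ∖ {a, b} in increasing order.
  punchIn₂ : ∀ {n} → Fin (suc (suc n)) → Fin (suc (suc n)) → Fin n → Fin (suc (suc n))
  punchIn₂ zero    zero    x       = suc (suc x)
  punchIn₂ zero    (suc b) x       = suc (punchIn b x)
  punchIn₂ (suc a) zero    x       = suc (punchIn a x)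
  punchIn₂ (suc a) (suc b) zero    = zero
  punchIn₂ (suc a) (suc b) (suc x) = suc (punchIn₂ a b x)

  punchIn-punchIn≡punchIn₂ : ∀ {n} (a : Fin (suc (suc n))) (l : Fin (suc n)) (x : Fin n) →
    punchIn a (punchIn l x) ≡ punchIn₂ a (punchIn a l) x
  punchIn-punchIn≡punchIn₂ zero    l       x       = refl
  punchIn-punchIn≡punchIn₂ (suc a) zero    x       = refl
  punchIn-punchIn≡punchIn₂ (suc a) (suc l) zero    = refl
  punchIn-punchIn≡punchIn₂ (suc a) (suc l) (suc x) = cong suc (punchIn-punchIn≡punchIn₂ a l x)

  punchIn₂-sym : ∀ {n} (a b : Fin (suc (suc n))) (x : Fin n) → punchIn₂ a b x ≡ punchIn₂ b a x
  punchIn₂-sym zero    zero    x       = refl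
  punchIn₂-sym zero    (suc b) x       = refl
  punchIn₂-sym (suc a) zero    x       = refl
  punchIn₂-sym (suc a) (suc b) zero    = refl
  punchIn₂-sym (suc a) (suc b) (suc x) = cong suc (punchIn₂-sym a b x)

  twoRowTerm : ∀ {n} → Matrix (suc (suc n)) → Fin (suc (suc n)) → Fin (suc (suc n)) → ℤ
  twoRowTerm M a b = sgnDiff a b * (sgn a * sgn b) *
    (M zero a * M (suc zero) b * det (λ r x → M (suc (suc r)) (punchIn₂ a b x)))

  det-twoRows : ∀ {n} (M : Matrix (suc (suc n))) → det M ≡ sumFin (λ a → sumFin (twoRowTerm M a))
  det-twoRows M = sumFin-cong λ a → begin
    laplaceTerm M a
      ≡⟨ cong (sgn a *_) (*-distribˡ-sumFin (M zero a) (laplaceTerm (minor M a))) ⟩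
    sgn a * sumFin (λ l → M zero a * laplaceTerm (minor M a) l)
      ≡⟨ *-distribˡ-sumFin (sgn a) (λ l → M zero a * laplaceTerm (minor M a) l) ⟩
    sumFin (λ l → sgn a * (M zero a * laplaceTerm (minor M a) l))
      ≡⟨ sumFin-cong (regroup a) ⟩
    sumFin (twoRowTerm M a ∘ punchIn a)
      ≡⟨ sym (+-identityˡ _) ⟩
    0ℤ + sumFin (twoRowTerm M a ∘ punchIn a)
      ≡⟨ sym (cong (_+ sumFin (twoRowTerm M a ∘ punchIn a)) (diagonal a)) ⟩
    twoRowTerm M a a + sumFin (twoRowTerm M a ∘ punchIn a)
      ≡⟨ sym (sumFin-remove (twoRowTerm M a) a) ⟩
    sumFin (twoRowTerm M a) ∎
    where
    open ≡-Reasoning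
    diagonal : ∀ a → twoRowTerm M a a ≡ 0ℤ
    diagonal a rewrite sgnDiff-diag a = refl
    regroup : ∀ a l → sgn a * (M zero a * laplaceTerm (minor M a) l) ≡ twoRowTerm M a (punchIn a l)
    regroup a l = begin
      sgn a * (M zero a * (sgn l * (M (suc zero) (punchIn a l) *
                                    det (λ r x → M (suc (suc r)) (punchIn a (punchIn l x))))))
        ≡⟨ cong (λ d → sgn a * (M zero a * (sgn l * (M (suc zero) (punchIn a l) * d))))
             (det-cong (λ r x → cong (M (suc (suc r))) (punchIn-punchIn≡punchIn₂ a l x))) ⟩
      sgn a * (M zero a * (sgn l * (M (suc zero) (punchIn a l) * d₂)))
        ≡⟨ cong (λ s → sgn a * (M zero a * (s * (M (suc zero) (punchIn a l) * d₂))))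
             (sym (sgnDiff-punchIn a l)) ⟩
      sgn a * (M zero a * (sgnDiff a b * sgn b * (M (suc zero) b * d₂)))
        ≡⟨ shuffle (sgnDiff a b) (sgn a) (sgn b) (M zero a) (M (suc zero) b) d₂ ⟩
      twoRowTerm M a b ∎
      where
      b = punchIn a l
      d₂ = det (λ r x → M (suc (suc r)) (punchIn₂ a b x))
      shuffle : ∀ e sa sb m₀ m₁ d → sa * (m₀ * (e * sb * (m₁ * d))) ≡ e * (sa * sb) * (m₀ * m₁ * d)
      shuffle = solve-∀

  -- swap c exchanges inject₁ c and suc c.
  swap : ∀ {n} → Fin (suc n) → Fin (suc (suc n)) → Fin (suc (suc n))
  swap zero          zero          = suc zero
  swap zero          (suc zero)    = zero
  swap zero          (suc (suc x)) = suc (suc x)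
  swap {suc n} (suc c) zero          = zero
  swap {suc n} (suc c) (suc x)       = suc (swap c x)

  sumFin-swap : ∀ {n} (c : Fin (suc n)) (f : Fin (suc (suc n)) → ℤ) → sumFin (f ∘ swap c) ≡ sumFin f
  sumFin-swap zero f = exchange (f (suc zero)) (f zero) (sumFin (λ x → f (suc (suc x))))
    where
    exchange : ∀ a b c → a + (b + c) ≡ b + (a + c)
    exchange = solve-∀
  sumFin-swap {suc n} (suc c) f = cong (f zero +_) (sumFin-swap c (f ∘ suc))

  -- Swapping the first two rows transposes the double expansion, and sgnDiff is antisymmetric.
  det-swap-rows₀ : ∀ {n} (M : Matrix (suc (suc n))) → det (M ∘ swap zero) ≡ - det M
  det-swap-rows₀ M = begin
    det (M ∘ swap zero)
      ≡⟨ det-twoRows (M ∘ swap zero) ⟩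
    sumFin (λ a → sumFin (λ b → twoRowTerm (M ∘ swap zero) a b))
      ≡⟨ sumFin-cong (λ a → trans (sumFin-cong (transposed a)) (sumFin-neg (λ b → twoRowTerm M b a))) ⟩
    sumFin (λ a → - sumFin (λ b → twoRowTerm M b a))
      ≡⟨ sumFin-neg (λ a → sumFin (λ b → twoRowTerm M b a)) ⟩
    - sumFin (λ a → sumFin (λ b → twoRowTerm M b a))
      ≡⟨ cong -_ (trans (sumFin-comm (λ a b → twoRowTerm M b a)) (sym (det-twoRows M))) ⟩
    - det M ∎
    where
    open ≡-Reasoning
    reorder : ∀ e sa sb p q d → e * (sa * sb) * (p * q * d) ≡ - ((- e) * (sb * sa) * (q * p * d))
    reorder = solve-∀
    transposed : ∀ a b → twoRowTerm (M ∘ swap zero) a b ≡ - twoRowTerm M b a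
    transposed a b = trans (reorder (sgnDiff a b) (sgn a) (sgn b) (M (suc zero) a) (M zero b) _)
      (cong₂ (λ e d → - (e * (sgn b * sgn a) * (M zero b * M (suc zero) a * d)))
        (sym (sgnDiff-antisym a b)) (det-cong (λ r x → cong (M (suc (suc r))) (punchIn₂-sym a b x))))

  det-swap-rows : ∀ {n} (c : Fin (suc n)) (M : Matrix (suc (suc n))) → det (M ∘ swap c) ≡ - det M
  det-swap-rows zero M = det-swap-rows₀ M
  det-swap-rows {suc n} (suc c) M = trans
    (sumFin-cong λ j → trans (cong (λ d → sgn j * (M zero j * d)) (det-swap-rows c (minor M j)))
      (pull (sgn j) (M zero j) (det (minor M j))))
    (sumFin-neg (laplaceTerm M))
    where
    pull : ∀ s a d → s * (a * - d) ≡ - (s * (a * d))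
    pull = solve-∀

  -- Deleting column j and then swapping: either j is one of the two swapped columns, which
  -- moves it by one place, or the swap survives in the minor as swap c′.
  data SwapPunchIn : ∀ {n} → Fin (suc n) → Fin (suc (suc n)) → Set where
    moves : ∀ {n} {c : Fin (suc n)} {j} → sgn (swap c j) ≡ - sgn j →
      (∀ x → swap c (punchIn j x) ≡ punchIn (swap c j) x) → SwapPunchIn c j
    fixes : ∀ {n} {c : Fin (suc (suc n))} {j} (c′ : Fin (suc n)) → swap c j ≡ j →
      (∀ x → swap c (punchIn j x) ≡ punchIn j (swap c′ x)) → SwapPunchIn c j

  swapPunchIn : ∀ {n} (c : Fin (suc n)) j → SwapPunchIn c j
  swapPunchIn zero zero = moves refl λ where
    zero    → refl
    (suc x) → refl
  swapPunchIn zero (suc zero) = moves refl λ where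
    zero    → refl
    (suc x) → refl
  swapPunchIn {suc n} zero (suc (suc j)) = fixes zero refl λ where
    zero          → refl
    (suc zero)    → refl
    (suc (suc x)) → refl
  swapPunchIn {suc n} (suc c) zero = fixes c refl λ x → refl
  swapPunchIn {suc n} (suc c) (suc j) with swapPunchIn c j
  ... | moves sgn-eq eq = moves (cong -_ sgn-eq) λ where
    zero    → refl
    (suc x) → cong suc (eq x)
  ... | fixes c′ fixed eq = fixes (suc c′) (cong suc fixed) λ where
    zero    → refl
    (suc x) → cong suc (eq x)

  mutual
    det-swap-cols : ∀ {n} (c : Fin (suc n)) (M : Matrix (suc (suc n))) →
      det (λ r x → M r (swap c x)) ≡ - det M
    det-swap-cols c M = trans (sumFin-cong (laplaceTerm-swap-cols c M))
      (trans (sumFin-neg (laplaceTerm M ∘ swap c)) (cong -_ (sumFin-swap c (laplaceTerm M))))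

    laplaceTerm-swap-cols : ∀ {n} (c : Fin (suc n)) (M : Matrix (suc (suc n))) j →
      laplaceTerm (λ r x → M r (swap c x)) j ≡ - laplaceTerm M (swap c j)
    laplaceTerm-swap-cols c M j with swapPunchIn c j
    ... | moves sgn-eq eq = trans
      (cong (λ d → sgn j * (M zero (swap c j) * d)) (det-cong (λ r x → cong (M (suc r)) (eq x))))
      (trans (flip (sgn j) (M zero (swap c j) * det (minor M (swap c j))))
        (cong (λ s → - (s * (M zero (swap c j) * det (minor M (swap c j))))) (sym sgn-eq)))
      where
      flip : ∀ s t → s * t ≡ - ((- s) * t)
      flip = solve-∀
    ... | fixes c′ fixed eq rewrite fixed = trans
      (cong (λ d → sgn j * (M zero j * d))
        (trans (det-cong (λ r x → cong (M (suc r)) (eq x))) (det-swap-cols c′ (minor M j))))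
      (pull (sgn j) (M zero j) (det (minor M j)))
      where
      pull : ∀ s a d → s * (a * - d) ≡ - (s * (a * d))
      pull = solve-∀

  det-rows01-equal : ∀ {n} (M : Matrix (suc (suc n))) → (∀ c → M zero c ≡ M (suc zero) c) → det M ≡ 0ℤ
  det-rows01-equal M eq = x≡-x⇒x≡0 (trans (det-cong unchanged) (det-swap-rows₀ M))
    where
    unchanged : ∀ r c → M r c ≡ M (swap zero r) c
    unchanged zero          c = eq c
    unchanged (suc zero)    c = sym (eq c)
    unchanged (suc (suc r)) c = refl

  -- A record, so that unification recovers σ without unfolding det.
  record PreservesDet {n} (σ : Fin n → Fin n) : Set where
    constructor preservesDet
    field det-conj : ∀ (M : Matrix n) → det (λ r c → M (σ r) (σ c)) ≡ det M
  open PreservesDet public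

  preservesDet-id : ∀ {n} → PreservesDet {n} id
  preservesDet-id = preservesDet λ M → refl

  preservesDet-cong : ∀ {n} {σ τ : Fin n → Fin n} → (∀ x → σ x ≡ τ x) →
    PreservesDet σ → PreservesDet τ
  preservesDet-cong eq pσ = preservesDet λ M →
    trans (det-cong (λ r c → cong₂ M (sym (eq r)) (sym (eq c)))) (det-conj pσ M)

  preservesDet-∘ : ∀ {n} {σ τ : Fin n → Fin n} →
    PreservesDet σ → PreservesDet τ → PreservesDet (σ ∘ τ)
  preservesDet-∘ {σ = σ} pσ pτ = preservesDet λ M →
    trans (det-conj pτ (λ r c → M (σ r) (σ c))) (det-conj pσ M)

  preservesDet-swap : ∀ {n} (c : Fin (suc n)) → PreservesDet (swap c)
  preservesDet-swap c = preservesDet λ M → begin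
    det (λ r x → M (swap c r) (swap c x)) ≡⟨ det-swap-rows c (λ r x → M r (swap c x)) ⟩
    - det (λ r x → M r (swap c x))        ≡⟨ cong -_ (det-swap-cols c M) ⟩
    - - det M                             ≡⟨ neg-involutive (det M) ⟩
    det M                                 ∎
    where open ≡-Reasoning

  toFront : ∀ {n} → Fin (suc n) → Fin (suc n) → Fin (suc n)
  toFront p zero    = p
  toFront p (suc x) = punchIn p x

  toFront-zero : ∀ {n} (x : Fin (suc n)) → toFront zero x ≡ x
  toFront-zero zero    = refl
  toFront-zero (suc x) = refl

  toFront-suc : ∀ {n} (p : Fin (suc n)) x → toFront (suc p) x ≡ swap p (toFront (inject₁ p) x)
  toFront-suc zero          zero          = refl
  toFront-suc zero          (suc zero)    = refl
  toFront-suc zero          (suc (suc x)) = refl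
  toFront-suc {suc n} (suc p) zero          = cong suc (toFront-suc p zero)
  toFront-suc {suc n} (suc p) (suc zero)    = refl
  toFront-suc {suc n} (suc p) (suc (suc x)) = cong suc (toFront-suc p (suc x))

  preservesDet-toFront-zero : ∀ {n} →
    PreservesDet (toFront {n} zero) × PreservesDet (lift 1 (toFront {n} zero))
  preservesDet-toFront-zero {n} =
    preservesDet-cong (λ x → sym (toFront-zero x)) preservesDet-id ,
    preservesDet-cong lift-id preservesDet-id
    where
    lift-id : ∀ x → x ≡ lift 1 (toFront {n} zero) x
    lift-id zero    = refl
    lift-id (suc x) = cong suc (sym (toFront-zero x))

  preservesDet-toFront : ∀ {n} (p : Fin (suc n)) →
    PreservesDet (toFront p) × PreservesDet (lift 1 (toFront p))
  preservesDet-toFront {zero}  zero = preservesDet-toFront-zero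
  preservesDet-toFront {suc n} = <-weakInduction P preservesDet-toFront-zero step
    where
    P : Fin (suc (suc n)) → Set
    P p = PreservesDet (toFront p) × PreservesDet (lift 1 (toFront p))
    step : ∀ p → P (inject₁ p) → P (suc p)
    step p (pρ , pρ′) =
      preservesDet-cong (λ x → sym (toFront-suc p x)) (preservesDet-∘ (preservesDet-swap p) pρ) ,
      preservesDet-cong lift-suc (preservesDet-∘ (preservesDet-swap (suc p)) pρ′)
      where
      lift-suc : ∀ x → swap (suc p) (lift 1 (toFront (inject₁ p)) x) ≡ lift 1 (toFront (suc p)) x
      lift-suc zero    = refl
      lift-suc (suc x) = cong suc (sym (toFront-suc p x))

  det-row0-two-ones : ∀ {n} (M : Matrix (suc (suc n))) → M zero zero ≡ 1ℤ → M zero (suc zero) ≡ 1ℤ →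
    (∀ w → M zero (suc (suc w)) ≡ 0ℤ) → det M ≡ det (minor M zero) - det (minor M (suc zero))
  det-row0-two-ones M m₀₀ m₀₁ m₀ = begin
    1ℤ * (M zero zero * det A) + (- 1ℤ * (M zero (suc zero) * det B) + rest)
      ≡⟨ cong₂ (λ x y → 1ℤ * (x * det A) + (- 1ℤ * (y * det B) + rest)) m₀₀ m₀₁ ⟩
    1ℤ * (1ℤ * det A) + (- 1ℤ * (1ℤ * det B) + rest)
      ≡⟨ cong (λ x → 1ℤ * (1ℤ * det A) + (- 1ℤ * (1ℤ * det B) + x)) (sumFin-zero _ rest-zero) ⟩
    1ℤ * (1ℤ * det A) + (- 1ℤ * (1ℤ * det B) + 0ℤ)
      ≡⟨ simplify (det A) (det B) ⟩
    det A - det B ∎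
    where
    open ≡-Reasoning
    A = minor M zero
    B = minor M (suc zero)
    rest = sumFin (λ w → laplaceTerm M (suc (suc w)))
    simplify : ∀ a b → 1ℤ * (1ℤ * a) + (- 1ℤ * (1ℤ * b) + 0ℤ) ≡ a - b
    simplify = solve-∀
    vanish : ∀ s d → s * (0ℤ * d) ≡ 0ℤ
    vanish = solve-∀
    rest-zero : ∀ w → laplaceTerm M (suc (suc w)) ≡ 0ℤ
    rest-zero w = trans (cong (λ x → sgn (suc (suc w)) * (x * det (minor M (suc (suc w))))) (m₀ w))
      (vanish (sgn (suc (suc w))) (det (minor M (suc (suc w)))))

  det-col0-difference : ∀ {n} (A B : Matrix (suc n)) → (∀ r c → A r (suc c) ≡ B r (suc c)) →
    (∀ r → A r zero ≡ B r zero + e₀ r) → det A - det B ≡ det (minor A zero)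
  det-col0-difference A B cols col₀ = begin
    det A - det B
      ≡⟨ cong (_- det B) (det-cong split) ⟩
    det (replaceCol0 (λ r → B r zero + e₀ r) A) - det B
      ≡⟨ cong (_- det B) (det-replaceCol0-+ (λ r → B r zero) e₀ A) ⟩
    det (replaceCol0 (λ r → B r zero) A) + det (replaceCol0 e₀ A) - det B
      ≡⟨ cong₂ (λ x y → x + y - det B) (det-cong col₀-of-B) (det-replaceCol0-e₀ A) ⟩
    det B + det (minor A zero) - det B
      ≡⟨ cancel (det B) (det (minor A zero)) ⟩
    det (minor A zero) ∎
    where
    open ≡-Reasoning
    cancel : ∀ b e → b + e - b ≡ e
    cancel = solve-∀
    split : ∀ r c → A r c ≡ replaceCol0 (λ r → B r zero + e₀ r) A r c
    split r zero    = col₀ r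
    split r (suc c) = refl
    col₀-of-B : ∀ r c → replaceCol0 (λ r → B r zero) A r c ≡ B r c
    col₀-of-B r zero    = refl
    col₀-of-B r (suc c) = cols r c

  -- Subtracting row 1 from row 0 leaves the row (1, 1, 0, …, 0), whose two minors differ only by e₀
  -- in column 0; the copy of row 1 left over has two equal rows.
  det-twins₀ : ∀ {n} (M : Matrix (suc (suc n))) →
    M zero zero ≡ 0ℤ → M zero (suc zero) ≡ 1ℤ →
    M (suc zero) zero ≡ - 1ℤ → M (suc zero) (suc zero) ≡ 0ℤ →
    (∀ w → M zero (suc (suc w)) ≡ M (suc zero) (suc (suc w))) →
    (∀ w → M (suc (suc w)) zero ≡ M (suc (suc w)) (suc zero)) →
    det M ≡ det (λ r c → M (suc (suc r)) (suc (suc c)))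
  det-twins₀ {n} M m₀₀ m₀₁ m₁₀ m₁₁ rows cols = begin
    det M
      ≡⟨ det-cong split ⟩
    det (replaceRow0 (λ j → d j + M (suc zero) j) M)
      ≡⟨ det-replaceRow0-+ d (M (suc zero)) M ⟩
    det (replaceRow0 d M) + det (replaceRow0 (M (suc zero)) M)
      ≡⟨ cong₂ _+_
           (det-row0-two-ones (replaceRow0 d M) (cong₂ _-_ m₀₀ m₁₀) (cong₂ _-_ m₀₁ m₁₁) d-rest)
                   (det-rows01-equal (replaceRow0 (M (suc zero)) M) (λ c → refl)) ⟩
    det (minor M zero) - det (minor M (suc zero)) + 0ℤ
      ≡⟨ +-identityʳ _ ⟩
    det (minor M zero) - det (minor M (suc zero))
      ≡⟨ det-col0-difference (minor M zero) (minor M (suc zero)) (λ r c → refl) col₀ ⟩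
    det (λ r c → M (suc (suc r)) (suc (suc c))) ∎
    where
    open ≡-Reasoning
    d : Fin (suc (suc n)) → ℤ
    d j = M zero j - M (suc zero) j
    sub-add : ∀ a b → a - b + b ≡ a
    sub-add = solve-∀
    split : ∀ r c → M r c ≡ replaceRow0 (λ j → d j + M (suc zero) j) M r c
    split zero    c = sym (sub-add (M zero c) (M (suc zero) c))
    split (suc r) c = refl
    d-rest : ∀ w → d (suc (suc w)) ≡ 0ℤ
    d-rest w = trans (cong (_- M (suc zero) (suc (suc w))) (rows w))
      (+-inverseʳ (M (suc zero) (suc (suc w))))
    col₀ : ∀ r → M (suc r) (suc zero) ≡ M (suc r) zero + e₀ r
    col₀ zero    = trans m₁₁ (sym (cong (_+ 1ℤ) m₁₀))
    col₀ (suc r) = trans (sym (cols r)) (sym (+-identityʳ (M (suc (suc r)) zero)))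

  det-twins : ∀ {n} (M : Matrix (suc (suc n))) (u : Fin (suc (suc n))) (v : Fin (suc n)) →
    M u u ≡ 0ℤ → M u (punchIn u v) ≡ 1ℤ →
    M (punchIn u v) u ≡ - 1ℤ → M (punchIn u v) (punchIn u v) ≡ 0ℤ →
    (∀ w → M u (punchIn u (punchIn v w)) ≡ M (punchIn u v) (punchIn u (punchIn v w))) →
    (∀ w → M (punchIn u (punchIn v w)) u ≡ M (punchIn u (punchIn v w)) (punchIn u v)) →
    det M ≡ det (λ r c → M (punchIn u (punchIn v r)) (punchIn u (punchIn v c)))
  det-twins {n} M u v m₀₀ m₀₁ m₁₀ m₁₁ rows cols = trans
    (sym (det-conj (preservesDet-∘ (proj₁ (preservesDet-toFront u)) (proj₂ (preservesDet-toFront v))) M))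
    (det-twins₀ (λ r c → M (π r) (π c)) m₀₀ m₀₁ m₁₀ m₁₁ rows cols)
    where
    π : Fin (suc (suc n)) → Fin (suc (suc n))
    π = toFront u ∘ lift 1 (toFront v)

module Blowups where

  open import Data.Nat using (zero; suc; _<_; _^_)
  open import Data.Nat.Induction using (<-wellFounded)
  open import Data.Fin using (zero; suc; punchIn; punchOut; _≟_)
  open import Data.Fin.Properties using (any?; punchIn-injective; punchInᵢ≢i; punchIn-punchOut)
  open import Data.Fin.Subset using (Subset; _∈_; _⊂_; ∣_∣)
  open import Data.Fin.Subset.Properties using (p⊂q⇒∣p∣<∣q∣)
  open import Data.Vec using (tabulate)
  open import Data.Vec.Properties using (lookup∘tabulate; []=⇒lookup; lookup⇒[]=)
  open import Data.Bool using (Bool; true; false; not; if_then_else_) renaming (_≟_ to _≟ᵇ_)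
  open import Data.Bool.Properties using (T-≡; ¬-not)
  open import Function.Bundles using (Equivalence)
  open import Data.Integer using (ℤ; +_; -_; 0ℤ; 1ℤ; +≤+) renaming (_≤_ to _≤ℤ_)
  open import Data.Product using (∃; ∃₂; _,_; proj₁; proj₂)
  open import Data.Sum using (_⊎_; inj₁; inj₂)
  open import Data.Empty using (⊥; ⊥-elim)
  open import Induction.WellFounded using (Acc; acc)
  open import Relation.Nullary using (Dec; yes; no; contradiction)
  open import Relation.Nullary.Decidable
    using (isYes; toWitness; fromWitness; decidable-stable; ¬?; _×-dec_)
  open import Relation.Binary.PropositionalEquality
  open import Function using (_∘_)
  open import Function.Definitions using (Injective)
  open Determinant

  module _ {m} (T : Tournament m) where

    arc-converse : ∀ {x y} → x ≢ y → arc T y x ≡ not (arc T x y)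
    arc-converse x≢y = tourn T _ _ (x≢y ∘ sym)

    arc-asym : ∀ {x y} → arc T x y ≡ true → arc T y x ≡ false
    arc-asym {x} {y} xy with x ≟ y
    ... | yes refl = contradiction (trans (sym xy) (irrefl T x)) λ ()
    ... | no x≢y   = trans (arc-converse x≢y) (cong not xy)

    arc-flip : ∀ {x y} → x ≢ y → arc T x y ≡ false → arc T y x ≡ true
    arc-flip x≢y xy = trans (arc-converse x≢y) (cong not xy)

    skew-irrefl : ∀ x → skew (arc T) x x ≡ 0ℤ
    skew-irrefl x rewrite irrefl T x = refl

    skew-arc : ∀ {x y} → arc T x y ≡ true → skew (arc T) x y ≡ 1ℤ
    skew-arc xy rewrite xy = refl

    skew-arc⁻ : ∀ {x y} → arc T x y ≡ true → skew (arc T) y x ≡ - 1ℤ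
    skew-arc⁻ xy rewrite arc-asym xy | xy = refl

  restrict : ∀ {m k} → Tournament m → (f : Fin k → Fin m) → Injective _≡_ _≡_ f → Tournament k
  restrict T f f-inj = record
    { arc    = λ x y → arc T (f x) (f y)
    ; irrefl = λ x → irrefl T (f x)
    ; tourn  = λ x y x≢y → tourn T (f x) (f y) (x≢y ∘ f-inj)
    }

  -- A subtournament of a transitive blowup of R, its vertices grouped by block (blocks may be empty).
  record Blowup {n} (R : Tournament n) (m : ℕ) : Set where
    field
      tournament        : Tournament m
      block             : Fin m → Fin n
      arc-between       : ∀ x y → block x ≢ block y → arc tournament x y ≡ arc R (block x) (block y)
      transitive-within : ∀ x y z → block x ≡ block y → block y ≡ block z →
        arc tournament x y ≡ true → arc tournament y z ≡ true → arc tournament z x ≡ true → ⊥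

  restrictBlowup : ∀ {n} {R : Tournament n} {m k} → Blowup R m →
    (f : Fin k → Fin m) → Injective _≡_ _≡_ f → Blowup R k
  restrictBlowup X f f-inj = record
    { tournament        = restrict tournament f f-inj
    ; block             = block ∘ f
    ; arc-between       = λ x y → arc-between (f x) (f y)
    ; transitive-within = λ x y z → transitive-within (f x) (f y) (f z)
    }
    where open Blowup X

  module _ {n} {R : Tournament n} {m} (X : Blowup R m) where

    open Blowup X

    private
      A : Fin m → Fin m → Bool
      A = arc tournament

    arc-trans-within : ∀ {x y z} → block x ≡ block y → block y ≡ block z →
      A x y ≡ true → A y z ≡ true → A x z ≡ true
    arc-trans-within {x} {y} {z} bxy byz xy yz with A x z in xz | x ≟ z
    ... | true  | _        = refl
    ... | false | yes refl = contradiction (trans (sym yz) (arc-asym tournament xy)) λ ()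
    ... | false | no x≢z   = ⊥-elim (transitive-within x y z bxy byz xy yz (arc-flip tournament x≢z xz))

    Out : Fin m → Fin m → Set
    Out u w = block w ≡ block u × A u w ≡ true

    out? : ∀ u w → Dec (Out u w)
    out? u w = (block w ≟ block u) ×-dec (A u w ≟ᵇ true)

    outNbhd : Fin m → Subset m
    outNbhd u = tabulate (isYes ∘ out? u)

    ∈-outNbhd⁺ : ∀ {u w} → Out u w → w ∈ outNbhd u
    ∈-outNbhd⁺ {u} {w} o = lookup⇒[]= w (outNbhd u)
      (trans (lookup∘tabulate (isYes ∘ out? u) w) (Equivalence.to T-≡ (fromWitness o)))

    ∈-outNbhd⁻ : ∀ {u w} → w ∈ outNbhd u → Out u w
    ∈-outNbhd⁻ {u} {w} w∈ = toWitness (Equivalence.from T-≡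
      (trans (sym (lookup∘tabulate (isYes ∘ out? u) w)) ([]=⇒lookup w∈)))

    out-trans : ∀ {u w x} → Out u w → Out w x → Out u x
    out-trans (bwu , uw) (bxw , wx) = trans bxw bwu , arc-trans-within (sym bwu) (sym bxw) uw wx

    outNbhd-⊂ : ∀ {u w} → Out u w → outNbhd w ⊂ outNbhd u
    outNbhd-⊂ {u} {w} o = (λ x∈ → ∈-outNbhd⁺ (out-trans o (∈-outNbhd⁻ x∈))) , w , ∈-outNbhd⁺ o ,
      λ w∈ → contradiction (trans (sym (proj₂ (∈-outNbhd⁻ w∈))) (irrefl tournament w)) λ ()

    collision-out : ∀ {p q} → p ≢ q → block p ≡ block q → ∃₂ Out
    collision-out {p} {q} p≢q bpq with A p q in pq
    ... | true  = p , q , sym bpq , pq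
    ... | false = q , p , bpq , arc-flip tournament p≢q pq

    record Covering (u v : Fin m) : Set where
      field
        out             : Out u v
        nothing-between : ∀ w → Out u w → A w v ≢ true

    -- A vertex strictly between u and v has a strictly smaller out-neighbourhood in the block.
    covering-within : ∀ {u v} → Acc _<_ ∣ outNbhd u ∣ → Out u v → ∃₂ Covering
    covering-within {u} {v} (acc rs) o with any? (λ w → out? u w ×-dec (A w v ≟ᵇ true))
    ... | no none = u , v , record { out = o ; nothing-between = λ w uw wv → none (w , uw , wv) }
    ... | yes (w , (bwu , uw) , wv) =
      covering-within (rs (p⊂q⇒∣p∣<∣q∣ (outNbhd-⊂ (bwu , uw)))) (trans (proj₁ o) (sym bwu) , wv)

    covering : ∀ {u v} → Out u v → ∃₂ Covering
    covering {u} = covering-within (<-wellFounded ∣ outNbhd u ∣)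

    covering-twin-out : ∀ {u v} → Covering u v → ∀ w → w ≢ u → w ≢ v → A u w ≡ A v w
    covering-twin-out {u} {v} c w w≢u w≢v with block w ≟ block u
    ... | no bw≢bu = trans (arc-between u w (bw≢bu ∘ sym))
      (trans (cong (λ b → arc R b (block w)) buv) (sym (arc-between v w (bw≢bu ∘ sym ∘ trans buv))))
      where buv = sym (proj₁ (Covering.out c))
    ... | yes bwu with A u w in uw
    ...   | true  = sym (arc-flip tournament w≢v (¬-not (Covering.nothing-between c w (bwu , uw))))
    ...   | false = sym (¬-not λ vw →
      transitive-within u v w (sym (proj₁ (Covering.out c))) (trans (proj₁ (Covering.out c)) (sym bwu))
        (proj₂ (Covering.out c)) vw (arc-flip tournament (w≢u ∘ sym) uw))

    covering-twin-in : ∀ {u v} → Covering u v → ∀ w → w ≢ u → w ≢ v → A w u ≡ A w v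
    covering-twin-in c w w≢u w≢v = trans (arc-converse tournament (w≢u ∘ sym))
      (trans (cong not (covering-twin-out c w w≢u w≢v)) (sym (arc-converse tournament (w≢v ∘ sym))))

  detT : ∀ {m} → Tournament m → ℤ
  detT T = det (skew (arc T))

  skew-≡ : ∀ {m k} {a : Fin m → Fin m → Bool} {b : Fin k → Fin k → Bool} {x y x′ y′} →
    a x y ≡ b x′ y′ → a y x ≡ b y′ x′ → skew a x y ≡ skew b x′ y′
  skew-≡ = cong₂ (λ p q → if p then 1ℤ else (if q then - 1ℤ else 0ℤ))

  InD-induced : ∀ {k n N} {a : Fin n → Fin n → Bool} {A : Fin N → Fin N → Bool} (g : Fin n → Fin N) →
    Injective _≡_ _≡_ g → (∀ i j → A (g i) (g j) ≡ a i j) → InD k A → InD k a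
  InD-induced {k} {a = a} {A} g g-injective arcs A∈D m f f-injective =
    subst (_≤ℤ + (k ^ 2))
      (det-cong λ i j → skew-≡ {a = λ i j → A (g (f i)) (g (f j))} {b = λ i j → a (f i) (f j)}
        (arcs (f i) (f j)) (arcs (f j) (f i)))
      (A∈D m (g ∘ f) (f-injective ∘ g-injective))

  remove-covering : ∀ {n} {R : Tournament n} {m} (X : Blowup R (suc (suc m))) u v →
    Covering X u (punchIn u v) →
    ∃ λ (Y : Blowup R m) → detT (Blowup.tournament X) ≡ detT (Blowup.tournament Y)
  remove-covering {m = m} X u v c = restrictBlowup X ι ι-injective ,
    det-twins (skew (arc tournament)) u v (skew-irrefl tournament u) (skew-arc tournament uv)
      (skew-arc⁻ tournament uv) (skew-irrefl tournament (punchIn u v))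
      (λ w → skew-≡ {a = arc tournament} {b = arc tournament} (twin-out w) (twin-in w))
      (λ w → skew-≡ {a = arc tournament} {b = arc tournament} (twin-in w) (twin-out w))
    where
    open Blowup X
    ι : Fin m → Fin (suc (suc m))
    ι = punchIn u ∘ punchIn v
    ι-injective : Injective _≡_ _≡_ ι
    ι-injective eq = punchIn-injective v _ _ (punchIn-injective u _ _ eq)
    ι≢u : ∀ w → ι w ≢ u
    ι≢u w = punchInᵢ≢i u (punchIn v w)
    ι≢v : ∀ w → ι w ≢ punchIn u v
    ι≢v w eq = punchInᵢ≢i v w (punchIn-injective u _ _ eq)
    uv = proj₂ (Covering.out c)
    twin-out : ∀ w → arc tournament u (ι w) ≡ arc tournament (punchIn u v) (ι w)
    twin-out w = covering-twin-out X c (ι w) (ι≢u w) (ι≢v w)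
    twin-in : ∀ w → arc tournament (ι w) u ≡ arc tournament (ι w) (punchIn u v)
    twin-in w = covering-twin-in X c (ι w) (ι≢u w) (ι≢v w)

  remove-collision : ∀ {n} {R : Tournament n} {m} (X : Blowup R (suc (suc m))) {p q} → p ≢ q →
    Blowup.block X p ≡ Blowup.block X q →
    ∃ λ (Y : Blowup R m) → detT (Blowup.tournament X) ≡ detT (Blowup.tournament Y)
  remove-collision X p≢q bpq with collision-out X p≢q bpq
  ... | _ , _ , o with covering X o
  ... | u , v , c =
    remove-covering X u (punchOut u≢v) (subst (Covering X u) (sym (punchIn-punchOut u≢v)) c)
    where
    u≢v : u ≢ v
    u≢v refl = contradiction (trans (sym (proj₂ (Covering.out c))) (irrefl (Blowup.tournament X) u)) λ ()

  injective-or-collision : ∀ {m k} (f : Fin m → Fin k) →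
    Injective _≡_ _≡_ f ⊎ ∃₂ (λ p q → p ≢ q × f p ≡ f q)
  injective-or-collision f with any? (λ p → any? (λ q → ¬? (p ≟ q) ×-dec (f p ≟ f q)))
  ... | yes (p , q , collision) = inj₂ (p , q , collision)
  ... | no none = inj₁ λ {p} {q} eq → decidable-stable (p ≟ q) (λ p≢q → none (p , q , p≢q , eq))

  detT-injective-block : ∀ {n} {R : Tournament n} {m} (X : Blowup R m) →
    Injective _≡_ _≡_ (Blowup.block X) →
    detT (Blowup.tournament X) ≡ det (skew (λ i j → arc R (Blowup.block X i) (Blowup.block X j)))
  detT-injective-block {R = R} X block-injective =
    det-cong λ i j → skew-≡ {a = arc tournament} {b = λ i j → arc R (block i) (block j)}
      (arc-block i j) (arc-block j i)
    where
    open Blowup X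
    arc-block : ∀ i j → arc tournament i j ≡ arc R (block i) (block j)
    arc-block i j with i ≟ j
    ... | yes refl = trans (irrefl tournament i) (sym (irrefl R (block i)))
    ... | no i≢j   = arc-between i j (i≢j ∘ block-injective)

  detT-bounded : ∀ {k n} {R : Tournament n} → InD k (arc R) → 1 ≤ k ^ 2 →
    ∀ m (X : Blowup R m) → detT (Blowup.tournament X) ≤ℤ + (k ^ 2)
  detT-bounded {k} R∈D k²≥1 zero X = +≤+ k²≥1
  detT-bounded {k} R∈D k²≥1 (suc m) X with injective-or-collision (Blowup.block X)
  ... | inj₁ block-injective = subst (_≤ℤ + (k ^ 2)) (sym (detT-injective-block X block-injective))
    (R∈D m (Blowup.block X) block-injective)
  detT-bounded {k} R∈D k²≥1 (suc zero) X | inj₂ (zero , zero , p≢q , _) = ⊥-elim (p≢q refl)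
  detT-bounded {k} R∈D k²≥1 (suc (suc m)) X | inj₂ (p , q , p≢q , bpq) =
    subst (_≤ℤ + (k ^ 2)) (sym (proj₂ reduced)) (detT-bounded {k} R∈D k²≥1 m (proj₁ reduced))
    where reduced = remove-collision X p≢q bpq

  blowup-InD : ∀ {k n N} {R : Tournament n} → InD k (arc R) → 1 ≤ k ^ 2 →
    (X : Blowup R N) → InD k (arc (Blowup.tournament X))
  blowup-InD {k} R∈D k²≥1 X m f f-injective =
    detT-bounded {k} R∈D k²≥1 (suc m) (restrictBlowup X f f-injective)

module TransitiveBlowup where

  open import Data.Nat using (zero; suc; _≤_)
  open import Data.Fin using (zero; suc; _≟_; splitAt; _↑ˡ_; _↑ʳ_; fromℕ<)
  open import Data.Fin.Properties using (splitAt-↑ˡ; splitAt-↑ʳ; splitAt⁻¹-↑ˡ; splitAt⁻¹-↑ʳ)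
  open import Data.Bool using (Bool; true; false; not)
  open import Data.Product using (Σ; _,_; proj₁)
  open import Data.Sum using (inj₁; inj₂)
  open import Data.Empty using (⊥; ⊥-elim)
  open import Relation.Nullary using (yes; no)
  open import Relation.Binary.PropositionalEquality
  open import Function using (_∘_)
  open import Function.Definitions using (Injective)
  open Blowups using (Blowup)

  encode : ∀ n (a : Fin n → ℕ) → Σ (Fin n) (Fin ∘ a) → Fin (total n a)
  encode (suc n) a (zero  , p) = p ↑ˡ total n (a ∘ suc)
  encode (suc n) a (suc i , q) = a zero ↑ʳ encode n (a ∘ suc) (i , q)

  decode-encode : ∀ n (a : Fin n → ℕ) d → decode n a (encode n a d) ≡ d
  decode-encode (suc n) a (zero , p) rewrite splitAt-↑ˡ (a zero) p (total n (a ∘ suc)) = refl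
  decode-encode (suc n) a (suc i , q)
    rewrite splitAt-↑ʳ (a zero) (total n (a ∘ suc)) (encode n (a ∘ suc) (i , q))
          | decode-encode n (a ∘ suc) (i , q) = refl

  encode-decode : ∀ n (a : Fin n → ℕ) x → encode n a (decode n a x) ≡ x
  encode-decode (suc n) a x with splitAt (a zero) x in eq
  ... | inj₁ p = splitAt⁻¹-↑ˡ eq
  ... | inj₂ y rewrite encode-decode n (a ∘ suc) y = splitAt⁻¹-↑ʳ eq

  decode-injective : ∀ n (a : Fin n → ℕ) → Injective _≡_ _≡_ (decode n a)
  decode-injective n a {x} {y} eq =
    trans (sym (encode-decode n a x)) (trans (cong (encode n a) eq) (encode-decode n a y))

  module _ {n} (R : Tournament n) (a : Fin n → ℕ) (T : (i : Fin n) → Tournament (a i)) where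

    blowArc'-same : ∀ i p q → blowArc' R a T i p i q ≡ arc (T i) p q
    blowArc'-same i p q with i ≟ i
    ... | yes refl = refl
    ... | no i≢i   = ⊥-elim (i≢i refl)

    blowArc'-between : ∀ i p j q → i ≢ j → blowArc' R a T i p j q ≡ arc R i j
    blowArc'-between i p j q i≢j with i ≟ j
    ... | yes i≡j = ⊥-elim (i≢j i≡j)
    ... | no _    = refl

    private
      pairArc : Σ (Fin n) (Fin ∘ a) → Σ (Fin n) (Fin ∘ a) → Bool
      pairArc (i , p) (j , q) = blowArc' R a T i p j q

      pairArc-irrefl : ∀ d → pairArc d d ≡ false
      pairArc-irrefl (i , p) = trans (blowArc'-same i p p) (irrefl (T i) p)

      pairArc-tourn : ∀ d e → d ≢ e → pairArc d e ≡ not (pairArc e d)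
      pairArc-tourn (i , p) (j , q) d≢e with i ≟ j
      ... | yes refl rewrite blowArc'-same i q p = tourn (T i) p q (d≢e ∘ cong (i ,_))
      ... | no i≢j rewrite blowArc'-between j q i p (i≢j ∘ sym) = tourn R i j i≢j

    blowupTournament : Tournament (total n a)
    blowupTournament = record
      { arc    = blowupArc R a T
      ; irrefl = λ x → pairArc-irrefl (decode n a x)
      ; tourn  = λ x y x≢y → pairArc-tourn (decode n a x) (decode n a y) (x≢y ∘ decode-injective n a)
      }

    blowup : (∀ i → Transitive (T i)) → Blowup R (total n a)
    blowup T-transitive = record
      { tournament        = blowupTournament
      ; block             = proj₁ ∘ decode n a
      ; arc-between       = λ x y → blowArc'-between _ _ _ _
      ; transitive-within = λ x y z → within (decode n a x) (decode n a y) (decode n a z)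
      }
      where
      within : ∀ d e f → proj₁ d ≡ proj₁ e → proj₁ e ≡ proj₁ f →
        pairArc d e ≡ true → pairArc e f ≡ true → pairArc f d ≡ true → ⊥
      within (i , p) (.i , q) (.i , r) refl refl
        rewrite blowArc'-same i p q | blowArc'-same i q r | blowArc'-same i r p = T-transitive i p q r

    module _ (a≥1 : ∀ i → 1 ≤ a i) where

      representative : Fin n → Fin (total n a)
      representative i = encode n a (i , fromℕ< (a≥1 i))

      representative-injective : Injective _≡_ _≡_ representative
      representative-injective {i} {j} eq =
        trans (sym (block-of i)) (trans (cong (proj₁ ∘ decode n a) eq) (block-of j))
        where
        block-of : ∀ i → proj₁ (decode n a (representative i)) ≡ i
        block-of i = cong proj₁ (decode-encode n a (i , fromℕ< (a≥1 i)))

      arc-representative : ∀ i j → blowupArc R a T (representative i) (representative j) ≡ arc R i j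
      arc-representative i j
        rewrite decode-encode n a (i , fromℕ< (a≥1 i)) | decode-encode n a (j , fromℕ< (a≥1 j))
        with i ≟ j
      ... | yes refl = trans (irrefl (T i) (fromℕ< (a≥1 i))) (sym (irrefl R i))
      ... | no _     = refl

open import Data.Nat using (suc; z≤n; s≤s; _^_; _*_)
open import Data.Product using (_,_)
open import Relation.Binary.PropositionalEquality using (refl)
open import Function.Bundles using (mk⇔)
open Blowups using (blowup-InD; InD-induced)
open TransitiveBlowup using (blowup; representative; representative-injective; arc-representative)

odd⇒1≤k² : ∀ k → Odd k → 1 ≤ k ^ 2
odd⇒1≤k² .(suc (2 * m)) (m , refl) = s≤s z≤n

theorem3p3 : (k : ℕ) → Odd k → (n : ℕ) (R : Tournament n) (a : Fin n → ℕ) →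
    (∀ i → 1 ≤ a i) → (T : (i : Fin n) → Tournament (a i)) → (∀ i → Transitive (T i)) →
    InD k (arc R) ⇔ InD k (blowupArc R a T)
theorem3p3 k k-odd n R a a≥1 T T-transitive = mk⇔
  (λ R∈D → blowup-InD {k} R∈D (odd⇒1≤k² k k-odd) (blowup R a T T-transitive))
  (InD-induced {k} {A = blowupArc R a T} (representative R a T a≥1)
    (representative-injective R a T a≥1) (arc-representative R a T a≥1))
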